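{- Let $\mathsf{M} = 0110100110010110\ldots$ be the Thue–Morse sequence. Then the streams $\Delta^n(\mathsf{M})$, $n = 0,1,2,\ldots$, are pairwise distinct; i.e. the $\Delta$-orbit of $\mathsf{M}$ is not (eventually) periodic.
   Context: Streams are maps $\sigma : \mathbb{N} \to \{0,1\}$. The difference operator $\Delta$ is defined by $\Delta(\sigma)(i) = \sigma(i) + \sigma(i+1)$ (addition modulo $2$), and $\Delta^n$ is its $n$-fold iterate. The Thue–Morse sequence $\mathsf{M}$ is defined by $\mathsf{M}(0)=0$, $\mathsf{M}(2n) = \mathsf{M}(n)$, $\mathsf{M}(2n+1) = 1 - \mathsf{M}(n)$ (equivalently, $\mathsf{M}(n)$ is the parity of the number of $1$s in the binary expansion of $n$). -}

module Defs where

open import Data.Bool using (Bool; true; false; not; _xor_)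
open import Data.Nat using (ℕ; zero; suc; _+_; _*_)
open import Data.Nat.Properties using (_≟_)
open import Relation.Binary.PropositionalEquality using (_≡_)

-- Streams over {0,1}, with 0 = false, 1 = true.
Stream : Set
Stream = ℕ → Bool

Δ : Stream → Stream
Δ σ i = σ i xor σ (suc i)

Δ^ : ℕ → Stream → Stream
Δ^ zero    σ = σ
Δ^ (suc n) σ = Δ (Δ^ n σ)

half : ℕ → ℕ
half zero          = zero
half (suc zero)    = zero
half (suc (suc n)) = suc (half n)

odd : ℕ → Bool
odd zero          = false
odd (suc zero)    = true
odd (suc (suc n)) = odd n

-- Parity of the number of 1s in the binary expansion of n, computed with fuel
-- (fuel ≥ n suffices since half n < n for n ≥ 1).
tmFuel : ℕ → ℕ → Bool
tmFuel zero       n = false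
tmFuel (suc fuel) n = odd n xor tmFuel fuel (half n)

-- Thue–Morse sequence: M 0 = 0, M (2n) = M n, M (2n+1) = 1 - M n.
M : Stream
M n = tmFuel n n

_≈ₛ_ : Stream → Stream → Set
σ ≈ₛ τ = ∀ i → σ i ≡ τ i

-- Over 𝔽₂ the binomial coefficients C(2ʲ, k) vanish for 0 < k < 2ʲ, so
-- Δ^(2ʲ) σ i = σ i + σ (i + 2ʲ). The second half of the first 2^(j+1)
-- letters of M is the complement of the first half, hence Δ^(2ʲ) M is
-- constantly 1 on [0, 2ʲ), and every further difference of it starts with 0.
-- If Δ^m M = Δ^(m+p) M with 0 < p, then also Δ^K M = Δ^(K+p) M for the power
-- of two K = 2^(m+p) > p, and comparing the first letters gives 1 = 0.
module Submission where

open import Defs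
open import Data.Bool using (Bool; true; false; not; _xor_)
open import Data.Bool.Properties using (xor-assoc; xor-same; not-distribʳ-xor; xor-inverseʳ)
open import Data.Nat using (ℕ; zero; suc; _+_; _*_; _∸_; _^_; _≤_; _<_; z≤n; s≤s)
open import Data.Nat.Properties
open import Function using (case_of_)
open import Relation.Binary.Definitions using (tri<; tri≈; tri>)
open import Relation.Binary.PropositionalEquality
open import Relation.Nullary using (¬_)

open ≡-Reasoning

Δ^-+ : ∀ a b σ → Δ^ (a + b) σ ≡ Δ^ a (Δ^ b σ)
Δ^-+ zero    b σ = refl
Δ^-+ (suc a) b σ = cong Δ (Δ^-+ a b σ)

Δ^-suc : ∀ d σ → Δ^ (suc d) σ ≡ Δ^ d (Δ σ)
Δ^-suc zero    σ = refl
Δ^-suc (suc d) σ = cong Δ (Δ^-suc d σ)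

Δ-cong : ∀ {σ τ} → σ ≈ₛ τ → Δ σ ≈ₛ Δ τ
Δ-cong σ≈τ i = cong₂ _xor_ (σ≈τ i) (σ≈τ (suc i))

Δ^-cong : ∀ r {σ τ} → σ ≈ₛ τ → Δ^ r σ ≈ₛ Δ^ r τ
Δ^-cong zero    σ≈τ = σ≈τ
Δ^-cong (suc r) σ≈τ = Δ-cong (Δ^-cong r σ≈τ)

xor-telescope : ∀ a b c → (a xor b) xor (b xor c) ≡ a xor c
xor-telescope a b c = begin
  (a xor b) xor (b xor c)  ≡⟨ xor-assoc a b (b xor c) ⟩
  a xor (b xor (b xor c))  ≡⟨ cong (a xor_) (sym (xor-assoc b b c)) ⟩
  a xor ((b xor b) xor c)  ≡⟨ cong (λ x → a xor (x xor c)) (xor-same b) ⟩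
  a xor c                  ∎

Δ^-2^ : ∀ j σ i → Δ^ (2 ^ j) σ i ≡ σ i xor σ (i + 2 ^ j)
Δ^-2^ zero    σ i = cong (λ k → σ i xor σ k) (+-comm 1 i)
Δ^-2^ (suc j) σ i = begin
  Δ^ (K + (K + 0)) σ i                        ≡⟨ cong (λ r → Δ^ (K + r) σ i) (+-identityʳ K) ⟩
  Δ^ (K + K) σ i                              ≡⟨ cong (λ τ → τ i) (Δ^-+ K K σ) ⟩
  Δ^ K (Δ^ K σ) i                             ≡⟨ Δ^-2^ j (Δ^ K σ) i ⟩
  Δ^ K σ i xor Δ^ K σ (i + K)                 ≡⟨ cong₂ _xor_ (Δ^-2^ j σ i) (Δ^-2^ j σ (i + K)) ⟩
  (σ i xor σ (i + K)) xor (σ (i + K) xor σ (i + K + K))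
                                              ≡⟨ xor-telescope (σ i) (σ (i + K)) (σ (i + K + K)) ⟩
  σ i xor σ (i + K + K)                       ≡⟨ cong (λ k → σ i xor σ k) index ⟩
  σ i xor σ (i + (K + (K + 0)))               ∎
  where
  K = 2 ^ j
  index : i + K + K ≡ i + (K + (K + 0))
  index = trans (+-assoc i K K) (cong (λ r → i + (K + r)) (sym (+-identityʳ K)))

ConstantBelow : ℕ → Bool → Stream → Set
ConstantBelow K c σ = ∀ i → i < K → σ i ≡ c

ConstantBelow-≤ : ∀ {K L c σ} → K ≤ L → ConstantBelow L c σ → ConstantBelow K c σ
ConstantBelow-≤ K≤L const i i<K = const i (<-≤-trans i<K K≤L)

Δ-constantBelow : ∀ {K c σ} → ConstantBelow (suc K) c σ → ConstantBelow K false (Δ σ)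
Δ-constantBelow {c = c} {σ} const i i<K = begin
  σ i xor σ (suc i)  ≡⟨ cong₂ _xor_ (const i (m<n⇒m<1+n i<K)) (const (suc i) (s≤s i<K)) ⟩
  c xor c            ≡⟨ xor-same c ⟩
  false              ∎

Δ^-constantBelow : ∀ d {K c σ} → ConstantBelow (suc d + K) c σ →
                   ConstantBelow K false (Δ^ (suc d) σ)
Δ^-constantBelow zero    const = Δ-constantBelow const
Δ^-constantBelow (suc d) {σ = σ} const i i<K = begin
  Δ^ (suc (suc d)) σ i  ≡⟨ cong (λ τ → τ i) (Δ^-suc (suc d) σ) ⟩
  Δ^ (suc d) (Δ σ) i    ≡⟨ Δ^-constantBelow d (Δ-constantBelow const) i i<K ⟩
  false                 ∎

n<2^n : ∀ n → n < 2 ^ n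
n<2^n zero    = s≤s z≤n
n<2^n (suc n) = +-mono-≤ (m^n>0 2 n) (subst (suc n ≤_) (sym (+-identityʳ (2 ^ n))) (n<2^n n))

half≤ : ∀ n f → n ≤ suc f → half n ≤ f
half≤ zero          f       _               = z≤n
half≤ (suc zero)    f       _               = z≤n
half≤ (suc (suc n)) (suc f) (s≤s (s≤s n≤f)) = s≤s (half≤ n f (m≤n⇒m≤1+n n≤f))

tmFuel-0 : ∀ f → tmFuel f 0 ≡ false
tmFuel-0 zero    = refl
tmFuel-0 (suc f) = tmFuel-0 f

tmFuel-irrelevant : ∀ f g n → n ≤ f → n ≤ g → tmFuel f n ≡ tmFuel g n
tmFuel-irrelevant zero    zero    n    _   _   = refl
tmFuel-irrelevant zero    (suc g) zero _   _   = sym (tmFuel-0 g)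
tmFuel-irrelevant (suc f) zero    zero _   _   = tmFuel-0 f
tmFuel-irrelevant (suc f) (suc g) n    n≤f n≤g =
  cong (odd n xor_) (tmFuel-irrelevant f g (half n) (half≤ n f n≤f) (half≤ n g n≤g))

M-unfold : ∀ n → M n ≡ odd n xor M (half n)
M-unfold zero    = refl
M-unfold (suc n) = cong (odd (suc n) xor_)
  (tmFuel-irrelevant n (half (suc n)) (half (suc n)) (half≤ (suc n) n ≤-refl) ≤-refl)

+-2*-suc : ∀ i P → i + 2 * suc P ≡ suc (suc (i + 2 * P))
+-2*-suc i P = begin
  i + 2 * suc P          ≡⟨ cong (i +_) (*-suc 2 P) ⟩
  i + suc (suc (2 * P))  ≡⟨ +-suc i (suc (2 * P)) ⟩
  suc (i + suc (2 * P))  ≡⟨ cong suc (+-suc i (2 * P)) ⟩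
  suc (suc (i + 2 * P))  ∎

odd-+-2* : ∀ i P → odd (i + 2 * P) ≡ odd i
odd-+-2* i zero    = cong odd (+-identityʳ i)
odd-+-2* i (suc P) = trans (cong odd (+-2*-suc i P)) (odd-+-2* i P)

half-+-2* : ∀ i P → half (i + 2 * P) ≡ half i + P
half-+-2* i zero    = trans (cong half (+-identityʳ i)) (sym (+-identityʳ (half i)))
half-+-2* i (suc P) = begin
  half (i + 2 * suc P)    ≡⟨ cong half (+-2*-suc i P) ⟩
  suc (half (i + 2 * P))  ≡⟨ cong suc (half-+-2* i P) ⟩
  suc (half i + P)        ≡⟨ sym (+-suc (half i) P) ⟩
  half i + suc P          ∎

half-<-2* : ∀ i P → i < 2 * P → half i < P
half-<-2* i             zero    ()
half-<-2* zero          (suc P) _   = s≤s z≤n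
half-<-2* (suc zero)    (suc P) _   = s≤s z≤n
half-<-2* (suc (suc i)) (suc P) i<2P
  rewrite *-suc 2 P = s≤s (half-<-2* i P (≤-pred (≤-pred i<2P)))

M-+-2^ : ∀ j i → i < 2 ^ j → M (i + 2 ^ j) ≡ not (M i)
M-+-2^ zero    zero    _        = refl
M-+-2^ zero    (suc i) (s≤s ())
M-+-2^ (suc j) i       i<2^1+j  = begin
  M (i + 2 * P)                                ≡⟨ M-unfold (i + 2 * P) ⟩
  odd (i + 2 * P) xor M (half (i + 2 * P))     ≡⟨ cong₂ (λ b k → b xor M k) (odd-+-2* i P) (half-+-2* i P) ⟩
  odd i xor M (half i + P)                     ≡⟨ cong (odd i xor_) (M-+-2^ j (half i) (half-<-2* i P i<2^1+j)) ⟩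
  odd i xor not (M (half i))                   ≡⟨ sym (not-distribʳ-xor (odd i) (M (half i))) ⟩
  not (odd i xor M (half i))                   ≡⟨ cong not (sym (M-unfold i)) ⟩
  not (M i)                                    ∎
  where
  P = 2 ^ j

Δ^2^-M-constantBelow : ∀ j → ConstantBelow (2 ^ j) true (Δ^ (2 ^ j) M)
Δ^2^-M-constantBelow j i i<2^j = begin
  Δ^ (2 ^ j) M i            ≡⟨ Δ^-2^ j M i ⟩
  M i xor M (i + 2 ^ j)     ≡⟨ cong (M i xor_) (M-+-2^ j i i<2^j) ⟩
  M i xor not (M i)         ≡⟨ xor-inverseʳ (M i) ⟩
  true                      ∎

Δ^-periodic-beyond : ∀ {m p K} σ → m ≤ K → Δ^ m σ ≈ₛ Δ^ (m + p) σ →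
                     Δ^ K σ ≈ₛ Δ^ p (Δ^ K σ)
Δ^-periodic-beyond {m} {p} {K} σ m≤K periodic i = begin
  Δ^ K σ i                 ≡⟨ cong (λ r → Δ^ r σ i) (sym (m∸n+n≡m m≤K)) ⟩
  Δ^ (k + m) σ i           ≡⟨ cong (λ τ → τ i) (Δ^-+ k m σ) ⟩
  Δ^ k (Δ^ m σ) i          ≡⟨ Δ^-cong k periodic i ⟩
  Δ^ k (Δ^ (m + p) σ) i    ≡⟨ cong (λ τ → τ i) (sym (Δ^-+ k (m + p) σ)) ⟩
  Δ^ (k + (m + p)) σ i     ≡⟨ cong (λ r → Δ^ r σ i) index ⟩
  Δ^ (p + K) σ i           ≡⟨ cong (λ τ → τ i) (Δ^-+ p K σ) ⟩
  Δ^ p (Δ^ K σ) i          ∎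
  where
  k = K ∸ m
  index : k + (m + p) ≡ p + K
  index = begin
    k + (m + p)  ≡⟨ sym (+-assoc k m p) ⟩
    k + m + p    ≡⟨ cong (_+ p) (m∸n+n≡m m≤K) ⟩
    K + p        ≡⟨ +-comm K p ⟩
    p + K        ∎

Δ^-M-aperiodic : ∀ m p → 0 < p → ¬ (Δ^ m M ≈ₛ Δ^ (m + p) M)
Δ^-M-aperiodic m p@(suc d) _ periodic = case true≡false of λ ()
  where
  K = 2 ^ (m + p)
  m+p<K : m + p < K
  m+p<K = n<2^n (m + p)
  p+1≤K : p + 1 ≤ K
  p+1≤K = subst (_≤ K) (+-comm 1 p) (≤-<-trans (m≤n+m p m) m+p<K)
  true≡false : true ≡ false
  true≡false = begin
    true             ≡⟨ sym (Δ^2^-M-constantBelow (m + p) 0 (m^n>0 2 (m + p))) ⟩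
    Δ^ K M 0         ≡⟨ Δ^-periodic-beyond M (≤-trans (m≤m+n m p) (<⇒≤ m+p<K)) periodic 0 ⟩
    Δ^ p (Δ^ K M) 0  ≡⟨ Δ^-constantBelow d (ConstantBelow-≤ p+1≤K (Δ^2^-M-constantBelow (m + p))) 0 (s≤s z≤n) ⟩
    false            ∎

Δ^-M-injective-< : ∀ {m n} → m < n → ¬ (Δ^ m M ≈ₛ Δ^ n M)
Δ^-M-injective-< {m} {n} m<n eq =
  Δ^-M-aperiodic m (n ∸ m) (m<n⇒0<n∸m m<n)
    (subst (λ r → Δ^ m M ≈ₛ Δ^ r M) (sym (m+[n∸m]≡n (<⇒≤ m<n))) eq)

mainTheorem2 : ∀ (m n : ℕ) → m ≢ n → ¬ (Δ^ m M ≈ₛ Δ^ n M)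
mainTheorem2 m n m≢n eq with <-cmp m n
... | tri< m<n _   _   = Δ^-M-injective-< m<n eq
... | tri≈ _   m≡n _   = m≢n m≡n
... | tri> _   _   n<m = Δ^-M-injective-< n<m (λ i → sym (eq i))
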